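{- Let $G$ be a connected graph of order at least three. Then every outer mutual-visibility set of $G$ is independent if and only if $G$ is edge-critical.
   Context: All graphs are finite and simple. For $X\subseteq V(G)$, two vertices $u,v$ are $X$-visible if there is a shortest $u,v$-path $P$ in $G$ with $V(P)\cap X\subseteq\{u,v\}$. A set $X$ is an outer mutual-visibility set if any two vertices of $X$ are $X$-visible and any $x\in X$, $y\in V(G)\setminus X$ are $X$-visible. A set is independent if it induces no edge. An edge $xy$ of $G$ is critical if there exist vertices $u,v$ with $\{u,v\}\neq\{x,y\}$ such that $d_{G-xy}(u,v)>d_G(u,v)$ (distance $\infty$ if disconnected); $G$ is edge-critical if all its edges are critical. -}

module Defs where

open import Data.Nat using (ℕ; zero; suc; _≤_; _<_)
open import Data.Fin using (Fin)
open import Data.Fin.Subset using (Subset; _∈_; _∉_)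
open import Data.Product using (Σ; ∃; ∃-syntax; _×_; _,_)
open import Data.Sum using (_⊎_)
open import Relation.Nullary using (¬_)
open import Relation.Binary.PropositionalEquality using (_≡_)
open import Relation.Binary.Definitions using (Decidable)

record Graph (n : ℕ) : Set₁ where
  field
    Adj    : Fin n → Fin n → Set
    adj?   : Decidable Adj
    sym    : ∀ {u v} → Adj u v → Adj v u
    irrefl : ∀ {u} → ¬ Adj u u
open Graph public

SamePair : ∀ {n} → Fin n → Fin n → Fin n → Fin n → Set
SamePair a b x y = (a ≡ x × b ≡ y) ⊎ (a ≡ y × b ≡ x)

data Walk {n : ℕ} (E : Fin n → Fin n → Set) : Fin n → Fin n → ℕ → Set where
  []  : ∀ {u} → Walk E u u zero
  _∷_ : ∀ {u w v k} → E u w → Walk E w v k → Walk E u v (suc k)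

data OnWalk {n : ℕ} {E : Fin n → Fin n → Set} (z : Fin n) :
            ∀ {u v k} → Walk E u v k → Set where
  here-nil : OnWalk z ([] {u = z})
  here     : ∀ {w v k} (e : E z w) (p : Walk E w v k) → OnWalk z (e ∷ p)
  there    : ∀ {u w v k} (e : E u w) {p : Walk E w v k} → OnWalk z p → OnWalk z (e ∷ p)

-- d_E(u,v) = k : there is a u,v-walk of length k and no shorter one.
-- (If no u,v-walk exists, the distance is ∞ and IsDist holds for no k.)
IsDist : ∀ {n} → (Fin n → Fin n → Set) → Fin n → Fin n → ℕ → Set
IsDist E u v k = Walk E u v k × (∀ j → j < k → ¬ Walk E u v j)

Visible : ∀ {n} → Graph n → Subset n → Fin n → Fin n → Set
Visible G X u v =
  Σ ℕ λ k → IsDist (Adj G) u v k ×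
    Σ (Walk (Adj G) u v k) λ P →
      ∀ z → OnWalk z P → z ∈ X → (z ≡ u ⊎ z ≡ v)

OuterMV : ∀ {n} → Graph n → Subset n → Set
OuterMV G X =
  (∀ x y → x ∈ X → y ∈ X → Visible G X x y) ×
  (∀ x y → x ∈ X → y ∉ X → Visible G X x y)

Independent : ∀ {n} → Graph n → Subset n → Set
Independent G X = ∀ x y → x ∈ X → y ∈ X → ¬ Adj G x y

Connected : ∀ {n} → Graph n → Set
Connected G = ∀ u v → ∃[ k ] Walk (Adj G) u v k

DelEdge : ∀ {n} → Graph n → Fin n → Fin n → Fin n → Fin n → Set
DelEdge G x y a b = Adj G a b × ¬ SamePair a b x y

-- xy is critical: ∃ u,v with {u,v} ≠ {x,y} and d_{G-xy}(u,v) > d_G(u,v)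
-- (d_{G-xy}(u,v) = ∞ allowed): d_G(u,v) = k finite and there is no
-- u,v-walk of length ≤ k in G - xy.
CriticalEdge : ∀ {n} → Graph n → Fin n → Fin n → Set
CriticalEdge G x y =
  Σ (Fin _) λ u → Σ (Fin _) λ v → ¬ SamePair u v x y ×
    Σ ℕ λ k → IsDist (Adj G) u v k ×
      (∀ j → j ≤ k → ¬ Walk (DelEdge G x y) u v j)

EdgeCritical : ∀ {n} → Graph n → Set
EdgeCritical G = ∀ x y → Adj G x y → CriticalEdge G x y

{-# OPTIONS --safe #-}
-- If xy is not critical, then from x (and likewise from y) every other vertex is reached by a
-- shortest path of G − xy, and such a path cannot pass through y, since a shortest path from x
-- meets the neighbour y only as its second vertex, via the deleted edge. Hence {x, y} is an
-- outer mutual-visibility set that is not independent.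
-- Conversely, let xy be critical for the pair u, v and let x, y lie in an outer mutual-visibility
-- set X. Every shortest u,v-path crosses xy, say as u…a b…v with u ≠ a (possibly after reversing
-- it). Since b ∈ X, u sees b along a shortest path avoiding a; continuing along b…v gives a
-- u,v-walk of length at most d(u, v) that avoids a, hence a walk in G − xy: a contradiction.
module Submission where

open import Defs
open import Data.Nat using (ℕ; zero; suc; _+_; _≤_; _<_; s≤s)
open import Data.Nat.Properties
  using (≤-refl; ≤-trans; ≮⇒≥; 1+n≰n; m≤n+m; +-monoʳ-≤; +-monoˡ-≤; +-comm; m≤n⇒m<n∨m≡n; anyUpTo?)
open import Data.Nat.Induction using (<-rec)
open import Data.Fin using (Fin; _≟_) renaming (zero to fzero; suc to fsuc)
open import Data.Fin.Properties using (any?; ∀-cons)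
open import Data.Fin.Subset using (Subset; _∈_; _∉_; ⁅_⁆; _∪_)
open import Data.Fin.Subset.Properties using (x∈⁅x⁆; x∈⁅y⁆⇒x≡y; x∈p∪q⁻; x∈p∪q⁺; _∈?_; ∪-comm)
open import Data.Product using (∃; ∃-syntax; Σ-syntax; _×_; _,_; proj₁; proj₂)
open import Data.Sum using (_⊎_; inj₁; inj₂; [_,_]; map₁; swap) renaming (map to map-⊎)
open import Data.Empty using (⊥-elim)
open import Function using (_∘_)
open import Function.Bundles using (_⇔_; mk⇔)
open import Relation.Nullary using (¬_; Dec; yes; no)
open import Relation.Nullary.Decidable using (_×-dec_; _⊎-dec_; ¬?)
open import Relation.Binary.Definitions using (Decidable)
open import Relation.Binary.PropositionalEquality using (_≡_; refl; cong; subst; subst₂) renaming (sym to ≡-sym)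

∀-⊎ : ∀ {n} {A : Set} {B : Fin n → Set} → (∀ z → A ⊎ B z) → A ⊎ (∀ z → B z)
∀-⊎ {zero}  f = inj₂ λ ()
∀-⊎ {suc n} f with f fzero | ∀-⊎ (f ∘ fsuc)
... | inj₁ a  | _       = inj₁ a
... | inj₂ _  | inj₁ a  = inj₁ a
... | inj₂ b₀ | inj₂ bs = inj₂ (∀-cons b₀ bs)

module _ {n : ℕ} {E : Fin n → Fin n → Set} where

  infixr 5 _++ʷ_
  _++ʷ_ : ∀ {u w v i j} → Walk E u w i → Walk E w v j → Walk E u v (i + j)
  []      ++ʷ q = q
  (e ∷ p) ++ʷ q = e ∷ (p ++ʷ q)

  OnWalk-++⁻ : ∀ {z u w v i j} (p : Walk E u w i) (q : Walk E w v j) →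
               OnWalk z (p ++ʷ q) → OnWalk z p ⊎ OnWalk z q
  OnWalk-++⁻ []      q o           = inj₂ o
  OnWalk-++⁻ (e ∷ p) q (here _ _)  = inj₁ (here e p)
  OnWalk-++⁻ (e ∷ p) q (there _ o) = map₁ (there e) (OnWalk-++⁻ p q o)

  OnWalk-start : ∀ {u v k} (p : Walk E u v k) → OnWalk u p
  OnWalk-start []      = here-nil
  OnWalk-start (e ∷ p) = here e p

  OnWalk-[]⁻ : ∀ {z u} → OnWalk z ([] {E = E} {u = u}) → z ≡ u
  OnWalk-[]⁻ here-nil = refl

  OnWalk-split : ∀ {z u v k} {p : Walk E u v k} → OnWalk z p →
                 ∃[ i ] ∃[ j ] Walk E u z i × Walk E z v j × i + j ≡ k
  OnWalk-split here-nil    = 0 , 0 , [] , [] , refl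
  OnWalk-split (here e p)  = 0 , _ , [] , e ∷ p , refl
  OnWalk-split (there e o) with OnWalk-split o
  ... | i , j , p , q , i+j≡k = suc i , j , e ∷ p , q , cong suc i+j≡k

  infixl 5 _∷ʳ_
  _∷ʳ_ : ∀ {u v w k} → Walk E u v k → E v w → Walk E u w (suc k)
  []      ∷ʳ f = f ∷ []
  (e ∷ p) ∷ʳ f = e ∷ (p ∷ʳ f)

  OnWalk-∷ʳ⁻ : ∀ {z u v w k} (p : Walk E u v k) (f : E v w) → OnWalk z (p ∷ʳ f) → OnWalk z p ⊎ z ≡ w
  OnWalk-∷ʳ⁻ []      f (here _ _)         = inj₁ here-nil
  OnWalk-∷ʳ⁻ []      f (there _ here-nil) = inj₂ refl
  OnWalk-∷ʳ⁻ (e ∷ p) f (here _ _)         = inj₁ (here e p)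
  OnWalk-∷ʳ⁻ (e ∷ p) f (there _ o)        = map₁ (there e) (OnWalk-∷ʳ⁻ p f o)

  data Crossing (B : Fin n → Fin n → Set) (u v : Fin n) : ℕ → Set where
    crossing : ∀ {a b i j} → Walk E u a i → E a b → B a b → Walk E b v j → Crossing B u v (suc (i + j))

  avoid-or-cross : ∀ {B : Fin n → Fin n → Set} → Decidable B → ∀ {u v k} → Walk E u v k →
                   Walk (λ a b → E a b × ¬ B a b) u v k ⊎ Crossing B u v k
  avoid-or-cross B? [] = inj₁ []
  avoid-or-cross B? {u} (_∷_ {w = w} e p) with B? u w
  ... | yes bad = inj₂ (crossing [] e bad p)
  ... | no good = map-⊎ ((e , good) ∷_) (λ { (crossing q f bad r) → crossing (e ∷ q) f bad r })
                        (avoid-or-cross B? p)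

  walk? : Decidable E → ∀ u v k → Dec (Walk E u v k)
  walk? E? u v zero with u ≟ v
  ... | yes refl = yes []
  ... | no u≢v   = no λ { [] → u≢v refl }
  walk? E? u v (suc k) with any? (λ w → E? u w ×-dec walk? E? w v k)
  ... | yes (_ , e , p) = yes (e ∷ p)
  ... | no ∄p           = no λ { (e ∷ p) → ∄p (_ , e , p) }

  IsDist-≤ : ∀ {u v k l} → IsDist E u v k → Walk E u v l → k ≤ l
  IsDist-≤ (_ , shortest) p = ≮⇒≥ λ l<k → shortest _ l<k p

  shortest-walk : Decidable E → ∀ {u v l} → Walk E u v l → ∃ (IsDist E u v)
  shortest-walk E? {u} {v} {l} = <-rec (λ m → Walk E u v m → ∃ (IsDist E u v)) shorten l
    where
    shorten : ∀ m → (∀ {j} → j < m → Walk E u v j → ∃ (IsDist E u v)) → Walk E u v m → ∃ (IsDist E u v)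
    shorten m rec p with anyUpTo? (walk? E? u v) m
    ... | yes (j , j<m , q) = rec j<m q
    ... | no ∄q             = m , p , λ j j<m q → ∄q (j , j<m , q)

  module _ (E-sym : ∀ {a b} → E a b → E b a) where

    reverse : ∀ {u v k} → Walk E u v k → Walk E v u k
    reverse []      = []
    reverse (e ∷ p) = reverse p ∷ʳ E-sym e

    OnWalk-reverse⁻ : ∀ {z u v k} (p : Walk E u v k) → OnWalk z (reverse p) → OnWalk z p
    OnWalk-reverse⁻ []      o = o
    OnWalk-reverse⁻ (e ∷ p) o with OnWalk-∷ʳ⁻ (reverse p) (E-sym e) o
    ... | inj₁ o′   = there e (OnWalk-reverse⁻ p o′)
    ... | inj₂ refl = here e p

    IsDist-reverse : ∀ {u v k} → IsDist E u v k → IsDist E v u k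
    IsDist-reverse (p , shortest) = reverse p , λ j j<k q → shortest j j<k (reverse q)

module _ {n : ℕ} {E F : Fin n → Fin n → Set} where

  mapʷ : (∀ {a b} → E a b → F a b) → ∀ {u v k} → Walk E u v k → Walk F u v k
  mapʷ f []      = []
  mapʷ f (e ∷ p) = f e ∷ mapʷ f p

  OnWalk-mapʷ⁻ : ∀ (f : ∀ {a b} → E a b → F a b) {z u v k} (p : Walk E u v k) →
                 OnWalk z (mapʷ f p) → OnWalk z p
  OnWalk-mapʷ⁻ f []      here-nil    = here-nil
  OnWalk-mapʷ⁻ f (e ∷ p) (here _ _)  = here e p
  OnWalk-mapʷ⁻ f (e ∷ p) (there _ o) = there e (OnWalk-mapʷ⁻ f p o)

  mapʷ-avoiding : ∀ a → (∀ {s t} → E s t → ¬ s ≡ a → ¬ t ≡ a → F s t) →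
                  ∀ {u v k} (p : Walk E u v k) → ¬ OnWalk a p → Walk F u v k
  mapʷ-avoiding a f []      a∉p = []
  mapʷ-avoiding a f (e ∷ p) a∉p =
    f e (λ { refl → a∉p (here e p) }) (λ { refl → a∉p (there e (OnWalk-start p)) })
      ∷ mapʷ-avoiding a f p (a∉p ∘ there e)

module _ {n : ℕ} {x y : Fin n} where

  samePair? : ∀ a b → Dec (SamePair a b x y)
  samePair? a b = ((a ≟ x) ×-dec (b ≟ y)) ⊎-dec ((a ≟ y) ×-dec (b ≟ x))

  SamePair-swap : ∀ {a b} → SamePair a b x y → SamePair b a x y
  SamePair-swap (inj₁ (a≡x , b≡y)) = inj₂ (b≡y , a≡x)
  SamePair-swap (inj₂ (a≡y , b≡x)) = inj₁ (b≡x , a≡y)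

  SamePair-fst : ∀ {a b} → SamePair a b x y → a ≡ x ⊎ a ≡ y
  SamePair-fst = map-⊎ proj₁ proj₁

  SamePair-snd : ∀ {a b} → SamePair a b x y → b ≡ x ⊎ b ≡ y
  SamePair-snd = SamePair-fst ∘ SamePair-swap

  SamePair-incident : ∀ {a s t} → a ≡ x ⊎ a ≡ y → SamePair s t x y → s ≡ a ⊎ t ≡ a
  SamePair-incident (inj₁ refl) (inj₁ (refl , refl)) = inj₁ refl
  SamePair-incident (inj₁ refl) (inj₂ (refl , refl)) = inj₂ refl
  SamePair-incident (inj₂ refl) (inj₁ (refl , refl)) = inj₂ refl
  SamePair-incident (inj₂ refl) (inj₂ (refl , refl)) = inj₁ refl

  ∈-pair⁺ : ∀ {z} → z ≡ x ⊎ z ≡ y → z ∈ ⁅ x ⁆ ∪ ⁅ y ⁆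
  ∈-pair⁺ (inj₁ refl) = x∈p∪q⁺ (inj₁ (x∈⁅x⁆ x))
  ∈-pair⁺ (inj₂ refl) = x∈p∪q⁺ {p = ⁅ x ⁆} (inj₂ (x∈⁅x⁆ y))

  ∈-pair⁻ : ∀ {z} → z ∈ ⁅ x ⁆ ∪ ⁅ y ⁆ → z ≡ x ⊎ z ≡ y
  ∈-pair⁻ z∈ = map-⊎ (x∈⁅y⁆⇒x≡y x) (x∈⁅y⁆⇒x≡y y) (x∈p∪q⁻ ⁅ x ⁆ ⁅ y ⁆ z∈)

module _ {n : ℕ} (G : Graph n) where

  dist : Connected G → ∀ u v → ∃ (IsDist (Adj G) u v)
  dist conn u v = shortest-walk (adj? G) (proj₂ (conn u v))

  DelEdge-dec : ∀ x y → Decidable (DelEdge G x y)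
  DelEdge-dec x y a b = adj? G a b ×-dec ¬? (samePair? a b)

  DelEdge-sym : ∀ x y {a b} → DelEdge G x y a b → DelEdge G x y b a
  DelEdge-sym x y (ab , ¬xy) = sym G ab , ¬xy ∘ SamePair-swap

  undelete : ∀ {x y u v k} → Walk (DelEdge G x y) u v k → Walk (Adj G) u v k
  undelete = mapʷ proj₁

  avoiding-walk-survives-deletion : ∀ {x y a} → a ≡ x ⊎ a ≡ y → ∀ {u v k} (p : Walk (Adj G) u v k) →
                                    ¬ OnWalk a p → Walk (DelEdge G x y) u v k
  avoiding-walk-survives-deletion a∈xy = mapʷ-avoiding _ λ st s≢a t≢a →
    st , [ s≢a , t≢a ] ∘ SamePair-incident a∈xy

  visible-refl : ∀ {X a} → Visible G X a a
  visible-refl = 0 , ([] , λ _ ()) , [] , λ _ o _ → inj₁ (OnWalk-[]⁻ o)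

  visible-edge : ∀ {X a b} → Adj G a b → Visible G X a b
  visible-edge {X} {a} {b} ab = 1 , (ab ∷ [] , λ { zero _ [] → irrefl G ab ; (suc _) (s≤s ()) _ }) , ab ∷ [] , ends
    where
    ends : ∀ z → OnWalk z (ab ∷ []) → z ∈ X → z ≡ a ⊎ z ≡ b
    ends _ (here _ _)         _ = inj₁ refl
    ends _ (there _ here-nil) _ = inj₂ refl

  visible-sym : ∀ {X a b} → Visible G X a b → Visible G X b a
  visible-sym (k , ab-dist , p , p-sees) =
    k , IsDist-reverse (sym G) ab-dist , reverse (sym G) p ,
    λ z o z∈X → swap (p-sees z (OnWalk-reverse⁻ (sym G) p o) z∈X)

  module _ {X : Subset n} (outer : OuterMV G X) where

    sees-members : ∀ u {b} → b ∈ X → Visible G X u b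
    sees-members u b∈X with u ∈? X
    ... | yes u∈X = proj₁ outer u _ u∈X b∈X
    ... | no  u∉X = visible-sym (proj₂ outer _ u b∈X u∉X)

    reroute : ∀ {u v a b i j} → a ∈ X → b ∈ X → ¬ u ≡ a → IsDist (Adj G) u v (suc (i + j)) →
              Walk (Adj G) u a i → Adj G a b → Walk (Adj G) b v j →
              ∃[ l ] l ≤ suc (i + j) × Σ[ p ∈ Walk (Adj G) u v l ] ¬ OnWalk a p
    reroute {u} {a = a} {i = i} {j} a∈X b∈X u≢a uv-dist p ab q with sees-members u b∈X
    ... | m , ub-dist , r , r-sees = m + j , +-monoˡ-≤ j (IsDist-≤ ub-dist (p ∷ʳ ab)) , r ++ʷ q , a∉r++q
      where
      a∉r : ¬ OnWalk a r
      a∉r o = [ u≢a ∘ ≡-sym , (λ { refl → irrefl G ab }) ] (r-sees a o a∈X)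

      a∉q : ¬ OnWalk a q
      a∉q o with OnWalk-split o
      ... | s , t , _ , q′ , s+t≡j =
        1+n≰n (≤-trans (IsDist-≤ uv-dist (p ++ʷ q′)) (+-monoʳ-≤ i (subst (t ≤_) s+t≡j (m≤n+m t s))))

      a∉r++q : ¬ OnWalk a (r ++ʷ q)
      a∉r++q = [ a∉r , a∉q ] ∘ OnWalk-++⁻ r q

    crossing-survives-deletion : ∀ {x y u v k} → x ∈ X → y ∈ X → ¬ SamePair u v x y →
                                 IsDist (Adj G) u v k → Crossing {E = Adj G} (λ a b → SamePair a b x y) u v k →
                                 ∃[ l ] l ≤ k × Walk (DelEdge G x y) u v l
    crossing-survives-deletion {x} {y} {u} {v} x∈X y∈X uv≢xy uv-dist
                               (crossing {a} {b} {i} {j} p ab ab≡xy q) = by-cases (u ≟ a)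
      where
      member : ∀ {z} → z ≡ x ⊎ z ≡ y → z ∈ X
      member = [ (λ { refl → x∈X }) , (λ { refl → y∈X }) ]

      vu-dist : IsDist (Adj G) v u (suc (j + i))
      vu-dist = subst (IsDist (Adj G) v u) (cong suc (+-comm i j)) (IsDist-reverse (sym G) uv-dist)

      by-cases : Dec (u ≡ a) → ∃[ l ] l ≤ suc (i + j) × Walk (DelEdge G x y) u v l
      by-cases (no u≢a) =
        let l , l≤k , s , a∉s = reroute (member (SamePair-fst ab≡xy)) (member (SamePair-snd ab≡xy))
                                        u≢a uv-dist p ab q
        in l , l≤k , avoiding-walk-survives-deletion (SamePair-fst ab≡xy) s a∉s
      by-cases (yes u≡a) =
        let l , l≤k , s , b∉s = reroute (member (SamePair-snd ab≡xy)) (member (SamePair-fst ab≡xy))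
                                        v≢b vu-dist (reverse (sym G) q) (sym G ab) (reverse (sym G) p)
        in l , subst (l ≤_) (cong suc (+-comm j i)) l≤k ,
           reverse (DelEdge-sym x y) (avoiding-walk-survives-deletion (SamePair-snd ab≡xy) s b∉s)
        where
        v≢b : ¬ v ≡ b
        v≢b v≡b = uv≢xy (subst₂ (λ s t → SamePair s t x y) (≡-sym u≡a) (≡-sym v≡b) ab≡xy)

  edgeCritical⇒independent : EdgeCritical G → ∀ X → OuterMV G X → Independent G X
  edgeCritical⇒independent critical X outer x y x∈X y∈X xy with critical x y xy
  ... | u , v , uv≢xy , k , uv-dist@(p , _) , no-short-walk with avoid-or-cross samePair? p
  ... | inj₁ p-avoids = no-short-walk k ≤-refl p-avoids
  ... | inj₂ p-crosses =
    let l , l≤k , s = crossing-survives-deletion outer x∈X y∈X uv≢xy uv-dist p-crosses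
    in no-short-walk l l≤k s

DeletionPreservesDist : ∀ {n} → Graph n → Fin n → Fin n → Fin n → Fin n → Set
DeletionPreservesDist G x y u v = ∃[ k ] IsDist (Adj G) u v k × Walk (DelEdge G x y) u v k

module _ {n : ℕ} (G : Graph n) {x y : Fin n} where

  preserved-or-critical : ∀ {u v k} → ¬ SamePair u v x y → IsDist (Adj G) u v k →
                          DeletionPreservesDist G x y u v ⊎ CriticalEdge G x y
  preserved-or-critical {u} {v} {k} uv≢xy uv-dist with walk? (DelEdge-dec G x y) u v k
  ... | yes p = inj₁ (k , uv-dist , p)
  ... | no ∄p = inj₂ (u , v , uv≢xy , k , uv-dist , no-short-walk)
    where
    no-short-walk : ∀ j → j ≤ k → ¬ Walk (DelEdge G x y) u v j
    no-short-walk j j≤k p with m≤n⇒m<n∨m≡n j≤k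
    ... | inj₁ j<k  = proj₂ uv-dist j j<k (undelete G p)
    ... | inj₂ refl = ∄p p

  preserving-walk-avoids-partner : ∀ {a c z k} → Adj G a c → SamePair a c x y → IsDist (Adj G) a z k →
                                   (p : Walk (DelEdge G x y) a z k) → ¬ OnWalk c p
  preserving-walk-avoids-partner ac ac≡xy az-dist p o with OnWalk-split o
  ... | _ , _ , []          , _ , _    = irrefl G ac
  ... | _ , _ , (e ∷ [])    , _ , _    = proj₂ e ac≡xy
  ... | _ , j , (_ ∷ (_ ∷ _)) , q , refl =
    proj₂ az-dist (suc j) (s≤s (s≤s (m≤n+m j _))) (ac ∷ undelete G q)

  preserved⇒visible : ∀ {a c z} → Adj G a c → SamePair a c x y → DeletionPreservesDist G x y a z →
                      Visible G (⁅ a ⁆ ∪ ⁅ c ⁆) a z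
  preserved⇒visible {a} {c} {z} ac ac≡xy (k , az-dist , p) = k , az-dist , undelete G p , sees
    where
    sees : ∀ w → OnWalk w (undelete G p) → w ∈ ⁅ a ⁆ ∪ ⁅ c ⁆ → w ≡ a ⊎ w ≡ z
    sees w o w∈ac with ∈-pair⁻ {x = a} w∈ac
    ... | inj₁ w≡a = inj₁ w≡a
    ... | inj₂ refl = ⊥-elim (preserving-walk-avoids-partner ac ac≡xy az-dist p (OnWalk-mapʷ⁻ proj₁ p o))

  pair-outerMV : Adj G x y →
                 (∀ z → z ∉ ⁅ x ⁆ ∪ ⁅ y ⁆ → DeletionPreservesDist G x y x z × DeletionPreservesDist G x y y z) →
                 OuterMV G (⁅ x ⁆ ∪ ⁅ y ⁆)
  pair-outerMV xy preserved = inside , outside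
    where
    within : ∀ {a b} → a ≡ x ⊎ a ≡ y → b ≡ x ⊎ b ≡ y → Visible G (⁅ x ⁆ ∪ ⁅ y ⁆) a b
    within (inj₁ refl) (inj₁ refl) = visible-refl G
    within (inj₁ refl) (inj₂ refl) = visible-edge G xy
    within (inj₂ refl) (inj₁ refl) = visible-edge G (sym G xy)
    within (inj₂ refl) (inj₂ refl) = visible-refl G

    inside : ∀ a b → a ∈ ⁅ x ⁆ ∪ ⁅ y ⁆ → b ∈ ⁅ x ⁆ ∪ ⁅ y ⁆ → Visible G (⁅ x ⁆ ∪ ⁅ y ⁆) a b
    inside a b a∈ b∈ = within (∈-pair⁻ a∈) (∈-pair⁻ b∈)

    outside : ∀ a b → a ∈ ⁅ x ⁆ ∪ ⁅ y ⁆ → b ∉ ⁅ x ⁆ ∪ ⁅ y ⁆ → Visible G (⁅ x ⁆ ∪ ⁅ y ⁆) a b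
    outside a b a∈ b∉ with ∈-pair⁻ a∈
    ... | inj₁ refl = preserved⇒visible xy (inj₁ (refl , refl)) (proj₁ (preserved b b∉))
    ... | inj₂ refl = subst (λ P → Visible G P y b) (∪-comm ⁅ y ⁆ ⁅ x ⁆)
                        (preserved⇒visible (sym G xy) (inj₂ (refl , refl)) (proj₂ (preserved b b∉)))

  critical-or-preserved : Connected G → ∀ z → CriticalEdge G x y ⊎
    (z ∉ ⁅ x ⁆ ∪ ⁅ y ⁆ → DeletionPreservesDist G x y x z × DeletionPreservesDist G x y y z)
  critical-or-preserved conn z with z ∈? ⁅ x ⁆ ∪ ⁅ y ⁆
  ... | yes z∈ = inj₂ λ z∉ → ⊥-elim (z∉ z∈)
  ... | no z∉ with preserved-or-critical (z∉ ∘ ∈-pair⁺ ∘ SamePair-snd) (proj₂ (dist G conn x z))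
                 | preserved-or-critical (z∉ ∘ ∈-pair⁺ ∘ SamePair-snd) (proj₂ (dist G conn y z))
  ... | inj₂ critical | _             = inj₁ critical
  ... | inj₁ _        | inj₂ critical = inj₁ critical
  ... | inj₁ from-x   | inj₁ from-y   = inj₂ λ _ → from-x , from-y

independent⇒edgeCritical : ∀ {n} (G : Graph n) → Connected G →
                           (∀ X → OuterMV G X → Independent G X) → EdgeCritical G
independent⇒edgeCritical G conn indep x y xy with ∀-⊎ (critical-or-preserved G conn)
... | inj₁ critical  = critical
... | inj₂ preserved =
  ⊥-elim (indep _ (pair-outerMV G xy preserved) x y (∈-pair⁺ (inj₁ refl)) (∈-pair⁺ (inj₂ refl)) xy)

theorem3p1 : (n : ℕ) (G : Graph n) → 3 ≤ n → Connected G →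
    ((∀ (X : Subset n) → OuterMV G X → Independent G X) ⇔ EdgeCritical G)
theorem3p1 n G _ conn = mk⇔ (independent⇒edgeCritical G conn) (edgeCritical⇒independent G)
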